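{- Let $G$ be an abelian group and let $C \subseteq G$ be a non-empty solid subset. If a subset $W \subseteq G$ satisfies $$G \setminus (W - W) = (C - C) \setminus \{0\},$$ then $C$ is a maximal supplement for $W$.
   Context: For subsets of $G$, $A - B = \{a - b : a\in A, b\in B\}$. $C \subseteq G$ is a supplement for $W \subseteq G$ if the translates $c + W$, $c \in C$, are pairwise disjoint; it is a maximal supplement for $W$ if moreover no proper superset of $C$ is a supplement for $W$. $C$ is solid if there is no set $D \supsetneq C$ with $D - D = C - C$. -}

module Defs where

open import Level using (Level; _⊔_)
open import Algebra.Bundles using (AbelianGroup)
open import Data.Product using (Σ; ∃; _×_; _,_)
open import Relation.Nullary using (¬_)
open import Relation.Unary using (Pred)

module _ {c ℓ : Level} (G : AbelianGroup c ℓ) where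
  open AbelianGroup G

  Subset : (p : Level) → Set (c ⊔ ℓ ⊔ Level.suc p)
  Subset p = Σ (Pred Carrier p) λ A → ∀ {x y} → x ≈ y → A x → A y

  _∋_ : ∀ {p} → Subset p → Carrier → Set p
  (A , _) ∋ x = A x

  _⊆ₛ_ : ∀ {p q} → Subset p → Subset q → Set (c ⊔ p ⊔ q)
  A ⊆ₛ B = ∀ x → A ∋ x → B ∋ x

  _⊊ₛ_ : ∀ {p q} → Subset p → Subset q → Set (c ⊔ p ⊔ q)
  A ⊊ₛ B = A ⊆ₛ B × ∃ λ x → B ∋ x × ¬ (A ∋ x)

  Diff : ∀ {p q} → Subset p → Subset q → Pred Carrier (c ⊔ ℓ ⊔ p ⊔ q)
  Diff A B x = ∃ λ a → ∃ λ b → A ∋ a × B ∋ b × x ≈ a ∙ (b ⁻¹)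

  _≐_ : ∀ {p q} → Pred Carrier p → Pred Carrier q → Set (c ⊔ p ⊔ q)
  P ≐ Q = (∀ x → P x → Q x) × (∀ x → Q x → P x)

  Translate : ∀ {p} → Carrier → Subset p → Pred Carrier (c ⊔ ℓ ⊔ p)
  Translate a W x = ∃ λ w → W ∋ w × x ≈ a ∙ w

  IsSupplement : ∀ {p q} → Subset p → Subset q → Set (c ⊔ ℓ ⊔ p ⊔ q)
  IsSupplement C W = ∀ a b → C ∋ a → C ∋ b → ¬ (a ≈ b) →
                     ∀ x → ¬ (Translate a W x × Translate b W x)

  IsMaximalSupplement : ∀ {p q} → Subset p → Subset q → Set (c ⊔ ℓ ⊔ Level.suc p ⊔ q)
  IsMaximalSupplement {p} C W =
    IsSupplement C W × ((D : Subset p) → C ⊊ₛ D → ¬ IsSupplement D W)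

  IsSolid : ∀ {p} → Subset p → Set (c ⊔ ℓ ⊔ Level.suc p)
  IsSolid {p} C = (D : Subset p) → C ⊊ₛ D → ¬ (Diff D D ≐ Diff C C)

-- C is a supplement because two distinct translates c + W, c' + W meet exactly
-- when c - c' ∈ W - W, which the hypothesis forbids for 0 ≠ c - c' ∈ C - C.
-- Conversely, every difference of distinct elements of a supplement D ⊇ C avoids
-- W - W and hence lies in C - C; so enlarging C by an element of D ∖ C would not
-- change C - C, contradicting solidity.
module Submission where

open import Defs
open import Algebra.Bundles using (AbelianGroup)
open import Data.Product using (∃; _×_; _,_; proj₁; proj₂)
open import Data.Sum using (_⊎_; inj₁; inj₂)
open import Relation.Nullary using (¬_)
import Algebra.Properties.AbelianGroup as AbelianGroupProperties
import Algebra.Properties.CommutativeSemigroup as CommutativeSemigroupProperties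
import Relation.Binary.Reasoning.Setoid as SetoidReasoning

module DifferenceSets {c ℓ} (G : AbelianGroup c ℓ) where
  open AbelianGroup G
  open AbelianGroupProperties G using (⁻¹-involutive; x∙y⁻¹≈ε⇒x≈y; \\-leftDividesˡ)
  open CommutativeSemigroupProperties commutativeSemigroup using (interchange; xy∙z≈x∙zy)
  open SetoidReasoning setoid

  _∈_ : ∀ {p} → Carrier → Subset G p → Set p
  x ∈ A = _∋_ G A x

  //-exchange : ∀ {x y u v} → x ∙ v ≈ u ∙ y → x ∙ y ⁻¹ ≈ u ∙ v ⁻¹
  //-exchange {x} {y} {u} {v} xv≈uy = begin
    x ∙ y ⁻¹                    ≈⟨ identityʳ _ ⟨
    (x ∙ y ⁻¹) ∙ ε              ≈⟨ ∙-congˡ (inverseʳ v) ⟨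
    (x ∙ y ⁻¹) ∙ (v ∙ v ⁻¹)     ≈⟨ interchange _ _ _ _ ⟩
    (x ∙ v) ∙ (y ⁻¹ ∙ v ⁻¹)     ≈⟨ ∙-cong xv≈uy (comm _ _) ⟩
    (u ∙ y) ∙ (v ⁻¹ ∙ y ⁻¹)     ≈⟨ interchange _ _ _ _ ⟩
    (u ∙ v ⁻¹) ∙ (y ∙ y ⁻¹)     ≈⟨ ∙-congˡ (inverseʳ y) ⟩
    (u ∙ v ⁻¹) ∙ ε              ≈⟨ identityʳ _ ⟩
    u ∙ v ⁻¹                    ∎

  //-exchange⁻ : ∀ {x y u v} → x ∙ y ⁻¹ ≈ u ∙ v ⁻¹ → x ∙ v ≈ u ∙ y
  //-exchange⁻ {x} {y} {u} {v} xy⁻¹≈uv⁻¹ = begin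
    x ∙ v             ≈⟨ ∙-congˡ (⁻¹-involutive v) ⟨
    x ∙ v ⁻¹ ⁻¹       ≈⟨ //-exchange xy⁻¹≈uv⁻¹ ⟩
    u ∙ y ⁻¹ ⁻¹       ≈⟨ ∙-congˡ (⁻¹-involutive y) ⟩
    u ∙ y             ∎

  //-translation-invariant : ∀ a b g → (a ∙ g) ∙ (b ∙ g) ⁻¹ ≈ a ∙ b ⁻¹
  //-translation-invariant a b g = //-exchange (xy∙z≈x∙zy a g b)

  Diff-respˡ : ∀ {p q} {A : Subset G p} {B : Subset G q} {x y} →
               x ≈ y → Diff G A B y → Diff G A B x
  Diff-respˡ x≈y (a , b , a∈A , b∈B , y≈ab⁻¹) = a , b , a∈A , b∈B , trans x≈y y≈ab⁻¹

  module _ {q} (W : Subset G q) where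

    translates-meet⇒Diff : ∀ {a b x} → Translate G a W x → Translate G b W x →
                           Diff G W W (a ∙ b ⁻¹)
    translates-meet⇒Diff {a} {b} {x} (v , v∈W , x≈av) (w , w∈W , x≈bw) =
      w , v , w∈W , v∈W , //-exchange (begin
        a ∙ v   ≈⟨ x≈av ⟨
        x       ≈⟨ x≈bw ⟩
        b ∙ w   ≈⟨ comm b w ⟩
        w ∙ b   ∎)

    Diff⇒translates-meet : ∀ {a b} → Diff G W W (a ∙ b ⁻¹) →
                           ∃ λ x → Translate G a W x × Translate G b W x
    Diff⇒translates-meet {a} {b} (v , w , v∈W , w∈W , ab⁻¹≈vw⁻¹) =
      a ∙ w , (w , w∈W , refl) , (v , v∈W , trans (//-exchange⁻ ab⁻¹≈vw⁻¹) (comm v b))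

    supplement⇒Diff∉ : ∀ {p} (X : Subset G p) → IsSupplement G X W →
                       ∀ {a b} → a ∈ X → b ∈ X → ¬ a ≈ b → ¬ Diff G W W (a ∙ b ⁻¹)
    supplement⇒Diff∉ _ supp a∈X b∈X a≉b ab⁻¹∈W-W with Diff⇒translates-meet ab⁻¹∈W-W
    ... | x , x∈a+W , x∈b+W = supp _ _ a∈X b∈X a≉b x (x∈a+W , x∈b+W)

    Diff∉⇒supplement : ∀ {p} (X : Subset G p) →
                       (∀ {a b} → a ∈ X → b ∈ X → ¬ a ≈ b → ¬ Diff G W W (a ∙ b ⁻¹)) →
                       IsSupplement G X W
    Diff∉⇒supplement _ avoids a b a∈X b∈X a≉b x (x∈a+W , x∈b+W) =
      avoids a∈X b∈X a≉b (translates-meet⇒Diff x∈a+W x∈b+W)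

  -- The singleton {d} is not a predicate of level p (it lives at the level of ≈),
  -- so instead of C ∪ {d} the enlargement E adjoins the new elements y of D whose
  -- shift y - d + c₀ lies in C: two such y differ by an element of C - C.
  solid⇒no-closed-enlargement :
    ∀ {p} {C D : Subset G p} → IsSolid G C → (∃ λ c₀ → c₀ ∈ C) → _⊆ₛ_ G C D →
    (∀ {a b} → a ∈ D → b ∈ D → ¬ a ≈ b → Diff G C C (a ∙ b ⁻¹)) →
    ¬ _⊊ₛ_ G C D
  solid⇒no-closed-enlargement {p} {C} {D} solid (c₀ , c₀∈C) C⊆D closed (_ , d , d∈D , d∉C) =
    solid E ((λ _ → inj₁) , d , inj₂ (d∈D , d∉C , shift-d∈C) , d∉C)
          ((λ _ → Diff-E⊆Diff-C) , λ _ → Diff-C⊆Diff-E)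
    where
    C-resp : ∀ {x y} → x ≈ y → x ∈ C → y ∈ C
    C-resp = proj₂ C

    D-resp : ∀ {x y} → x ≈ y → x ∈ D → y ∈ D
    D-resp = proj₂ D

    shift : Carrier → Carrier
    shift y = y ∙ (d ⁻¹ ∙ c₀)

    shift-d∈C : shift d ∈ C
    shift-d∈C = C-resp (sym (\\-leftDividesˡ d c₀)) c₀∈C

    New : Carrier → Set p
    New y = y ∈ D × ¬ y ∈ C × shift y ∈ C

    New-resp : ∀ {x y} → x ≈ y → New x → New y
    New-resp x≈y (x∈D , x∉C , shiftx∈C) =
      D-resp x≈y x∈D , (λ y∈C → x∉C (C-resp (sym x≈y) y∈C)) , C-resp (∙-congʳ x≈y) shiftx∈C

    E : Subset G p
    E = (λ y → y ∈ C ⊎ New y) , λ { x≈y (inj₁ x∈C) → inj₁ (C-resp x≈y x∈C)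
                                 ; x≈y (inj₂ x-new) → inj₂ (New-resp x≈y x-new) }

    differences : ∀ {a b} → a ∈ E → b ∈ E → Diff G C C (a ∙ b ⁻¹)
    differences (inj₁ a∈C) (inj₁ b∈C) = _ , _ , a∈C , b∈C , refl
    differences (inj₁ a∈C) (inj₂ (b∈D , b∉C , _)) =
      closed (C⊆D _ a∈C) b∈D (λ a≈b → b∉C (C-resp a≈b a∈C))
    differences (inj₂ (a∈D , a∉C , _)) (inj₁ b∈C) =
      closed a∈D (C⊆D _ b∈C) (λ a≈b → a∉C (C-resp (sym a≈b) b∈C))
    differences {a} {b} (inj₂ (_ , _ , shifta∈C)) (inj₂ (_ , _ , shiftb∈C)) =
      shift a , shift b , shifta∈C , shiftb∈C , sym (//-translation-invariant a b (d ⁻¹ ∙ c₀))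

    Diff-E⊆Diff-C : ∀ {x} → Diff G E E x → Diff G C C x
    Diff-E⊆Diff-C (a , b , a∈E , b∈E , x≈ab⁻¹) =
      Diff-respˡ {A = C} {B = C} x≈ab⁻¹ (differences a∈E b∈E)

    Diff-C⊆Diff-E : ∀ {x} → Diff G C C x → Diff G E E x
    Diff-C⊆Diff-E (a , b , a∈C , b∈C , x≈ab⁻¹) = a , b , inj₁ a∈C , inj₁ b∈C , x≈ab⁻¹

  ≉⇒//≉ε : ∀ {a b} → ¬ a ≈ b → ¬ a ∙ b ⁻¹ ≈ ε
  ≉⇒//≉ε a≉b ab⁻¹≈ε = a≉b (x∙y⁻¹≈ε⇒x≈y _ _ ab⁻¹≈ε)

open DifferenceSets

lemma5p2 : ∀ {c ℓ p} (G : AbelianGroup c ℓ) (C W : Subset G p) →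
    (∃ λ x → _∋_ G C x) →
    IsSolid G C →
    (∀ x → (¬ Diff G W W x) → (Diff G C C x × ¬ AbelianGroup._≈_ G x (AbelianGroup.ε G))) →
    (∀ x → (Diff G C C x × ¬ AbelianGroup._≈_ G x (AbelianGroup.ε G)) → ¬ Diff G W W x) →
    IsMaximalSupplement G C W
lemma5p2 {p = p} G C W nonempty solid outside⇒CC CC⇒outside = supplement , maximal
  where
  supplement : IsSupplement G C W
  supplement = Diff∉⇒supplement G W C λ a∈C b∈C a≉b →
    CC⇒outside _ ((_ , _ , a∈C , b∈C , AbelianGroup.refl G) , ≉⇒//≉ε G a≉b)

  maximal : (D : Subset G p) → _⊊ₛ_ G C D → ¬ IsSupplement G D W
  maximal D C⊊D D-supplement =
    solid⇒no-closed-enlargement G {C = C} {D} solid nonempty (proj₁ C⊊D)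
      (λ a∈D b∈D a≉b → proj₁ (outside⇒CC _ (supplement⇒Diff∉ G W D D-supplement a∈D b∈D a≉b)))
      C⊊D
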